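{- Let $n>2$ and $k>0$ be integers with $n>k$, and let $\mathbb K$ be a field. Then \[\mathrm{H}^i_\mu(D_{k,n-k};\mathbb K)\cong\begin{cases}\mathbb K^{(k-1)(n-k-1)} & \text{if } i=2,\\ 0&\text{otherwise.}\end{cases}\]
   Context: For integers $n,m\ge 0$, the dandelion graph $D_{n,m}$ is the digraph with vertices $v_0,w_1,\dots,w_n,x_1,\dots,x_m$ and edges $(w_i,v_0)$ for $i=1,\dots,n$ and $(v_0,x_j)$ for $j=1,\dots,m$. A multipath of a digraph $G$ is a spanning subgraph each of whose connected components is a single vertex or a simple directed path (no repeated vertex, not a cycle). Multipath cohomology $\mathrm{H}^*_\mu(G;\mathbb K)$ is the cohomology of the complex whose degree $n$ part has basis $b_H$ for multipaths $H$ with $n$ edges, with $d b_H=\sum_e(-1)^{\epsilon(H,H\cup e)}b_{H\cup e}$ over edges $e\notin H$ with $H\cup e$ a multipath, where $\epsilon(H,H\cup e)$ is the number of edges of $H$ preceding $e$ in a fixed total order of $E(G)$. -}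

module Defs where

open import Level using (Level; _⊔_) renaming (suc to lsuc)
open import Data.Nat using (ℕ; zero; suc; _≤_) renaming (_+_ to _+ℕ_)
open import Data.Bool using (Bool; true; false; _∧_; if_then_else_)
open import Data.Fin using (Fin; toℕ; splitAt; _↑ˡ_; _↑ʳ_) renaming (_≟_ to _≟ᶠ_; _<?_ to _<ᶠ?_)
open import Data.Fin.Subset using (Subset; _∈_; ∣_∣) renaming (_-_ to _∖_)
open import Data.Fin.Subset.Properties using (_∈?_)
open import Data.List using (List; []; _∷_)
open import Data.List.Relation.Unary.All using (All)
open import Data.Product using (Σ; ∃; _×_; _,_)
open import Data.Sum using (inj₁; inj₂)
open import Relation.Nullary using (¬_; does)
open import Relation.Binary.PropositionalEquality using (_≡_)
open import Algebra.Bundles using (CommutativeRing)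

record Field (c ℓ : Level) : Set (lsuc (c ⊔ ℓ)) where
  field
    commutativeRing : CommutativeRing c ℓ
  open CommutativeRing commutativeRing public
  field
    0≉1     : ¬ (0# ≈ 1#)
    inverse : ∀ x → ¬ (x ≈ 0#) → ∃ λ y → x * y ≈ 1#

-- Finite digraphs with numbered vertices and numbered edges.
-- The numbering of the edges (order of Fin E) is the fixed total order
-- of E(G) used in the signs of the differential.

record Digraph : Set where
  field
    V   : ℕ
    E   : ℕ
    src : Fin E → Fin V
    tgt : Fin E → Fin V

countFin : {n : ℕ} → (Fin n → Bool) → ℕ
countFin {zero}  p = 0
countFin {suc n} p = (if p Fin.zero then 1 else 0) +ℕ countFin (λ i → p (Fin.suc i))

-- Vertices (Fin (1 + n + m)): 0 = v₀, 1+i = w_{i+1} (i < n),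
--   1+n+j = x_{j+1} (j < m).
-- Edges (Fin (n + m)): edge i (i < n) is (w_{i+1}, v₀),
--   edge n+j is (v₀, x_{j+1}).

Dandelion : ℕ → ℕ → Digraph
Dandelion n m = record { V = suc (n +ℕ m) ; E = n +ℕ m ; src = s ; tgt = t }
  where
  s : Fin (n +ℕ m) → Fin (suc (n +ℕ m))
  s e with splitAt n e
  ... | inj₁ i = Fin.suc (i ↑ˡ m)
  ... | inj₂ j = Fin.zero
  t : Fin (n +ℕ m) → Fin (suc (n +ℕ m))
  t e with splitAt n e
  ... | inj₁ i = Fin.zero
  ... | inj₂ j = Fin.suc (n ↑ʳ j)

module MultipathCohomology {c ℓ : Level} (K : Field c ℓ) (G : Digraph) where
  open Field K
  open Digraph G

  -- edges of a spanning subgraph H (a subset of the edge set)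
  indeg : Subset E → Fin V → ℕ
  indeg H v = countFin (λ e → does (e ∈? H) ∧ does (tgt e ≟ᶠ v))

  outdeg : Subset E → Fin V → ℕ
  outdeg H v = countFin (λ e → does (e ∈? H) ∧ does (src e ≟ᶠ v))

  Walk : Fin V → List (Fin E) → Fin V → Set
  Walk u []       w = u ≡ w
  Walk u (e ∷ es) w = (src e ≡ u) × Walk (tgt e) es w

  HasCycle : Subset E → Set
  HasCycle H = Σ (Fin E) λ e → Σ (List (Fin E)) λ es →
                 All (_∈ H) (e ∷ es) × Walk (src e) (e ∷ es) (src e)

  -- multipath: spanning subgraph whose components are isolated vertices
  -- or simple directed paths
  IsMultipath : Subset E → Set
  IsMultipath H = (∀ v → indeg H v ≤ 1) × (∀ v → outdeg H v ≤ 1) × ¬ HasCycle H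

  -- An element of the degree-i cochain group is the coefficient vector
  -- Σ_H f(H) b_H, where H ranges over multipaths with i edges; it is
  -- represented by f : Subset E → K, only its values on such H matter.
  Cochain : Set c
  Cochain = Subset E → Carrier

  _≈[_]_ : Cochain → ℕ → Cochain → Set (ℓ)
  f ≈[ i ] g = ∀ H → IsMultipath H → ∣ H ∣ ≡ i → f H ≈ g H

  sumFin : {n : ℕ} → (Fin n → Carrier) → Carrier
  sumFin {zero}  f = 0#
  sumFin {suc n} f = f Fin.zero + sumFin (λ i → f (Fin.suc i))

  sign : ℕ → Carrier
  sign zero    = 1#
  sign (suc k) = - sign k

  -- ε(H \ e, H): number of edges of H preceding e
  ε : Subset E → Fin E → ℕ
  ε H e = countFin (λ e′ → does (e′ ∈? H) ∧ does (e′ <ᶠ? e))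

  -- the differential: d(Σ f(H) b_H) = Σ_H f(H) Σ_e (-1)^ε b_{H∪e};
  -- coefficient of b_T is Σ_{e ∈ T} (-1)^{ε(T∖e,T)} f(T∖e)
  -- (for T a multipath, T∖e is always a multipath).
  d : Cochain → Cochain
  d f T = sumFin (λ e → if does (e ∈? T) then sign (ε T e) * f (T ∖ e) else 0#)

  zeroC : Cochain
  zeroC _ = 0#

  IsCocycle : ℕ → Cochain → Set ℓ
  IsCocycle i f = d f ≈[ suc i ] zeroC

  IsCoboundary : ℕ → Cochain → Set (c ⊔ ℓ)
  IsCoboundary zero    f = Level.Lift c (f ≈[ 0 ] zeroC)
  IsCoboundary (suc i) f = Σ Cochain λ g → f ≈[ suc i ] d g

  lincomb : {r : ℕ} → (Fin r → Carrier) → (Fin r → Cochain) → Cochain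
  lincomb a z H = sumFin (λ j → a j * z j H)

  _−C_ : Cochain → Cochain → Cochain
  (f −C g) H = f H - g H

  -- H^i_μ(G; K) ≅ K^r: there are cocycles z₁,…,z_r such that the linear
  -- map K^r → H^i, a ↦ [Σ a_j z_j], is bijective (surjective: every
  -- cocycle is cohomologous to such a combination; injective: such a
  -- combination is a coboundary only if all a_j = 0).
  CohomologyIso : ℕ → ℕ → Set (c ⊔ ℓ)
  CohomologyIso i r =
    Σ (Fin r → Cochain) λ z →
      (∀ j → IsCocycle i (z j)) ×
      (∀ f → IsCocycle i f → Σ (Fin r → Carrier) λ a → IsCoboundary i (f −C lincomb a z)) ×
      (∀ a → IsCoboundary i (lincomb a z) → ∀ j → a j ≈ 0#)

H[_,_]≅K^_ : {c ℓ : Level} (K : Field c ℓ) → Digraph → ℕ → ℕ → Set (c ⊔ ℓ)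
H[ K , G ]≅K^ r = λ i → MultipathCohomology.CohomologyIso K G i r

-- A multipath of D_{k,m} has at most one edge into v₀ and at most one edge out of it, so its
-- multipath complex is K → K^{k+m} → K^{k×m} → 0.  Seen as a function on multipaths, d f takes
-- the value f(∅) on every single edge and the value f(v₀x_j) − f(w_iv₀) on the path w_i v₀ x_j.
-- Hence H⁰ = 0 as soon as k > 0; a 1-cocycle is constant on the edges, so it is the coboundary
-- of a constant; and H² is the space of k × m matrices modulo the matrices of the form v_j − u_i.
-- The matrices vanishing on the first row and the first column form a complement of the latter,
-- of dimension (k − 1)(m − 1).
module Submission where

open import Defs
open import Level using (Level; lift)
open import Function using (_∘_; const)
open import Data.Nat using (ℕ; zero; suc; _≤_; _<_; _∸_; _*_; z≤n; s≤s) renaming (_+_ to _+ℕ_)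
import Data.Nat.Properties as ℕ
open import Data.Nat.Properties
  using (+-mono-≤; ≤-refl; ≤-trans; ≤-reflexive; <⇒≤; <⇒≱; <-irrefl; <-asym;
         <-≤-trans; m≤m+n; m≤n⇒m≤1+n; n≤0⇒n≡0; m<n⇒0<n∸m)
open import Data.Bool using (Bool; true; false; _∧_; if_then_else_)
open import Data.Empty using (⊥-elim)
open import Data.Maybe using (Maybe; just; nothing; maybe′)
open import Data.Sum using (inj₁; inj₂; [_,_]′)
open import Data.Product using (Σ; ∃; ∃₂; _×_; _,_; proj₁; proj₂; uncurry)
import Data.Product
open import Data.Fin using (Fin; zero; suc; toℕ; splitAt; _↑ˡ_; _↑ʳ_; combine; remQuot)
  renaming (_≟_ to _≟ᶠ_; _<?_ to _<ᶠ?_)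
open import Data.Fin.Properties
  using (toℕ<n; toℕ-↑ˡ; toℕ-↑ʳ; splitAt-↑ˡ; splitAt-↑ʳ; 0≢1+n; suc-injective; remQuot-combine;
         combine-remQuot)
open import Data.Fin.Subset using (Subset; inside; outside; _∈_; ∣_∣; ⊥; ⁅_⁆) renaming (_-_ to _∖_)
open import Data.Fin.Subset.Properties
  using (_∈?_; ∉⊥; x∈⁅x⁆; x∈⁅y⁆⇒x≡y; x≢y⇒x∉⁅y⁆; ∣⊥∣≡0; ∣⁅x⁆∣≡1; p─⊥≡p)
open import Data.List using ([]; _∷_)
open import Data.Vec using ([]; _∷_; _++_; here; there)
import Data.Vec as Vec
open import Data.Vec.Properties using (++-injective; ≡-dec)
import Data.Bool.Properties as Bool
open import Algebra.Bundles using (Ring)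
import Algebra.Properties.Ring as RingProperties
open import Relation.Nullary using (¬_; Dec; does)
open import Relation.Nullary.Decidable using (dec-true; dec-false)
open import Relation.Binary.PropositionalEquality as ≡ using (_≡_; _≢_; cong; cong₂; subst)

_≟ₛ_ : ∀ {n} (p q : Subset n) → Dec (p ≡ q)
_≟ₛ_ = ≡-dec Bool._≟_

count∈ : ∀ {n} → Subset n → (Fin n → Bool) → ℕ
count∈ p q = countFin (λ x → does (x ∈? p) ∧ q x)

countFin-cong : ∀ {n} {p q : Fin n → Bool} → (∀ x → p x ≡ q x) → countFin p ≡ countFin q
countFin-cong {zero} _ = ≡.refl
countFin-cong {suc n} p≗q =
  cong₂ (λ b r → (if b then 1 else 0) +ℕ r) (p≗q zero) (countFin-cong (p≗q ∘ suc))

countFin-splitAt : ∀ k {m} (p : Fin (k +ℕ m) → Bool) →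
                   countFin p ≡ countFin (p ∘ (_↑ˡ m)) +ℕ countFin (p ∘ (k ↑ʳ_))
countFin-splitAt zero p = ≡.refl
countFin-splitAt (suc k) p =
  ≡.trans (cong ((if p zero then 1 else 0) +ℕ_) (countFin-splitAt k (p ∘ suc)))
          (≡.sym (ℕ.+-assoc (if p zero then 1 else 0) _ _))

count∈-cong : ∀ {n} (p : Subset n) {q r} → (∀ x → q x ≡ r x) → count∈ p q ≡ count∈ p r
count∈-cong p q≗r = countFin-cong (λ x → cong (does (x ∈? p) ∧_) (q≗r x))

∈?-↑ˡ : ∀ {k m} (A : Subset k) (B : Subset m) i → does (i ↑ˡ m ∈? A ++ B) ≡ does (i ∈? A)
∈?-↑ˡ (inside ∷ A) B zero = ≡.refl
∈?-↑ˡ (outside ∷ A) B zero = ≡.refl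
∈?-↑ˡ (_ ∷ A) B (suc i) = ∈?-↑ˡ A B i

∈?-↑ʳ : ∀ {k m} (A : Subset k) (B : Subset m) j → does (k ↑ʳ j ∈? A ++ B) ≡ does (j ∈? B)
∈?-↑ʳ [] B j = ≡.refl
∈?-↑ʳ (_ ∷ A) B j = ∈?-↑ʳ A B j

count∈-++ : ∀ {k m} (A : Subset k) (B : Subset m) q →
            count∈ (A ++ B) q ≡ count∈ A (q ∘ (_↑ˡ m)) +ℕ count∈ B (q ∘ (k ↑ʳ_))
count∈-++ {k} A B q = ≡.trans (countFin-splitAt k _) (cong₂ _+ℕ_
  (countFin-cong λ i → cong (_∧ _) (∈?-↑ˡ A B i))
  (countFin-cong λ j → cong (_∧ _) (∈?-↑ʳ A B j)))

count∈-≤ : ∀ {n} (p : Subset n) q → count∈ p q ≤ ∣ p ∣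
count∈-≤ [] q = z≤n
count∈-≤ (outside ∷ p) q = count∈-≤ p (q ∘ suc)
count∈-≤ (inside ∷ p) q with q zero
... | true = s≤s (count∈-≤ p (q ∘ suc))
... | false = m≤n⇒m≤1+n (count∈-≤ p (q ∘ suc))

count∈-all : ∀ {n} (p : Subset n) {q} → (∀ x → q x ≡ true) → count∈ p q ≡ ∣ p ∣
count∈-all [] _ = ≡.refl
count∈-all (outside ∷ p) q≡true = count∈-all p (q≡true ∘ suc)
count∈-all (inside ∷ p) q≡true rewrite q≡true zero = cong suc (count∈-all p (q≡true ∘ suc))

count∈-none : ∀ {n} (p : Subset n) {q} → (∀ x → x ∈ p → q x ≡ false) → count∈ p q ≡ 0
count∈-none [] _ = ≡.refl
count∈-none (outside ∷ p) q≡false = count∈-none p (λ x x∈p → q≡false (suc x) (there x∈p))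
count∈-none (inside ∷ p) q≡false rewrite q≡false zero here =
  count∈-none p (λ x x∈p → q≡false (suc x) (there x∈p))

count∈-⁅⁆ : ∀ {n} (i : Fin n) {q} → q i ≡ false → count∈ ⁅ i ⁆ q ≡ 0
count∈-⁅⁆ i {q} qi≡false =
  count∈-none ⁅ i ⁆ (λ x x∈⁅i⁆ → subst (λ y → q y ≡ false) (≡.sym (x∈⁅y⁆⇒x≡y i x∈⁅i⁆)) qi≡false)

∣++∣ : ∀ {k m} (A : Subset k) (B : Subset m) → ∣ A ++ B ∣ ≡ ∣ A ∣ +ℕ ∣ B ∣
∣++∣ [] B = ≡.refl
∣++∣ (inside ∷ A) B = cong suc (∣++∣ A B)
∣++∣ (outside ∷ A) B = ∣++∣ A B

∣p∣≡0⇒p≡⊥ : ∀ {n} (p : Subset n) → ∣ p ∣ ≡ 0 → p ≡ ⊥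
∣p∣≡0⇒p≡⊥ [] _ = ≡.refl
∣p∣≡0⇒p≡⊥ (outside ∷ p) ∣p∣≡0 = cong (outside ∷_) (∣p∣≡0⇒p≡⊥ p ∣p∣≡0)

++-∖-↑ˡ : ∀ {k m} (A : Subset k) (B : Subset m) i → (A ++ B) ∖ (i ↑ˡ m) ≡ (A ∖ i) ++ B
++-∖-↑ˡ (_ ∷ A) B zero = cong (outside ∷_) (≡.trans (p─⊥≡p (A ++ B)) (cong (_++ B) (≡.sym (p─⊥≡p A))))
++-∖-↑ˡ (x ∷ A) B (suc i) = cong (x ∷_) (++-∖-↑ˡ A B i)

++-∖-↑ʳ : ∀ {k m} (A : Subset k) (B : Subset m) j → (A ++ B) ∖ (k ↑ʳ j) ≡ A ++ (B ∖ j)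
++-∖-↑ʳ [] B j = ≡.refl
++-∖-↑ʳ (x ∷ A) B j = cong (x ∷_) (++-∖-↑ʳ A B j)

⁅x⁆∖x≡⊥ : ∀ {n} (x : Fin n) → ⁅ x ⁆ ∖ x ≡ ⊥
⁅x⁆∖x≡⊥ zero = cong (outside ∷_) (p─⊥≡p ⊥)
⁅x⁆∖x≡⊥ (suc x) = cong (outside ∷_) (⁅x⁆∖x≡⊥ x)

⁅⁆-injective : ∀ {n} {x y : Fin n} → ⁅ x ⁆ ≡ ⁅ y ⁆ → x ≡ y
⁅⁆-injective {x = x} {y} eq = x∈⁅y⁆⇒x≡y y (subst (x ∈_) eq (x∈⁅x⁆ x))

↑ˡ<↑ʳ : ∀ {k m} (i : Fin k) (j : Fin m) → toℕ (i ↑ˡ m) < toℕ (k ↑ʳ j)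
↑ˡ<↑ʳ {k} {m} i j rewrite toℕ-↑ˡ i m | toℕ-↑ʳ k j = <-≤-trans (toℕ<n i) (m≤m+n k (toℕ j))

⟦_⟧ : ∀ {n} → Maybe (Fin n) → Subset n
⟦ nothing ⟧ = ⊥
⟦ just i ⟧ = ⁅ i ⁆

size : ∀ {A : Set} → Maybe A → ℕ
size nothing = 0
size (just _) = 1

size≤1 : ∀ {A : Set} (a : Maybe A) → size a ≤ 1
size≤1 nothing = z≤n
size≤1 (just _) = ≤-refl

∣⟦⟧∣ : ∀ {n} (a : Maybe (Fin n)) → ∣ ⟦ a ⟧ ∣ ≡ size a
∣⟦⟧∣ {n} nothing = ∣⊥∣≡0 n
∣⟦⟧∣ (just i) = ∣⁅x⁆∣≡1 i

count∈-⟦⟧≤1 : ∀ {n} (a : Maybe (Fin n)) q → count∈ ⟦ a ⟧ q ≤ 1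
count∈-⟦⟧≤1 a q = ≤-trans (count∈-≤ ⟦ a ⟧ q) (≤-trans (≤-reflexive (∣⟦⟧∣ a)) (size≤1 a))

∣p∣≤1⇒p≡⟦⟧ : ∀ {n} (p : Subset n) → ∣ p ∣ ≤ 1 → ∃ λ a → p ≡ ⟦ a ⟧
∣p∣≤1⇒p≡⟦⟧ [] _ = nothing , ≡.refl
∣p∣≤1⇒p≡⟦⟧ (inside ∷ p) (s≤s ∣p∣≤0) = just zero , cong (inside ∷_) (∣p∣≡0⇒p≡⊥ p (n≤0⇒n≡0 ∣p∣≤0))
∣p∣≤1⇒p≡⟦⟧ (outside ∷ p) ∣p∣≤1 with ∣p∣≤1⇒p≡⟦⟧ p ∣p∣≤1
... | nothing , ≡.refl = nothing , ≡.refl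
... | just i , ≡.refl = just (suc i) , ≡.refl

module RowColumnMatrices {c ℓ : Level} (R : Ring c ℓ) (k′ m′ : ℕ) where
  open Ring R hiding (_*_; zero)
  open RingProperties R using (⁻¹-anti-homo‿-; xyx⁻¹≈y; x∙y⁻¹≈ε⇒x≈y; x≈y⇒x∙y⁻¹≈ε)
  open import Relation.Binary.Reasoning.Setoid setoid

  Matrix : Set c
  Matrix = Fin (suc k′) → Fin (suc m′) → Carrier

  x-[x-y]≈y : ∀ x y → x - (x - y) ≈ y
  x-[x-y]≈y x y = begin
    x - (x - y)  ≈⟨ +-congˡ (⁻¹-anti-homo‿- x y) ⟩
    x + (y - x)  ≈⟨ sym (+-assoc x y (- x)) ⟩
    x + y - x    ≈⟨ xyx⁻¹≈y x y ⟩
    y            ∎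

  padded : (Fin (k′ * m′) → Carrier) → Matrix
  padded a zero j = 0#
  padded a (suc p) zero = 0#
  padded a (suc p) (suc q) = a (combine p q)

  interiorIndex : Fin (k′ * m′) → Fin (suc k′) × Fin (suc m′)
  interiorIndex t = Data.Product.map suc suc (remQuot m′ t)

  interiorIndex-combine : ∀ p q → interiorIndex (combine p q) ≡ (suc p , suc q)
  interiorIndex-combine p q = cong (Data.Product.map suc suc) (remQuot-combine p q)

  interiorIndex≡⇒≡combine : ∀ t {p q} → interiorIndex t ≡ (suc p , suc q) → t ≡ combine p q
  interiorIndex≡⇒≡combine t eq = ≡.trans (≡.sym (combine-remQuot {k′} m′ t))
    (cong (uncurry combine) (cong₂ _,_ (suc-injective (cong proj₁ eq)) (suc-injective (cong proj₂ eq))))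

  interior : Matrix → Fin (k′ * m′) → Carrier
  interior M = uncurry M ∘ interiorIndex

  padded-interior : ∀ M → (∀ j → M zero j ≈ 0#) → (∀ i → M i zero ≈ 0#) →
                    ∀ i j → padded (interior M) i j ≈ M i j
  padded-interior M row₀ col₀ zero j = sym (row₀ j)
  padded-interior M row₀ col₀ (suc p) zero = sym (col₀ (suc p))
  padded-interior M row₀ col₀ (suc p) (suc q) =
    reflexive (cong (uncurry M) (interiorIndex-combine p q))

  doubleDifference : Matrix → Matrix
  doubleDifference F i j = F i j - (F zero j - (F zero zero - F i zero))

  padded-doubleDifference : ∀ F i j →
    F i j - padded (interior (doubleDifference F)) i j ≈ F zero j - (F zero zero - F i zero)
  padded-doubleDifference F i j = begin
    F i j - padded (interior (doubleDifference F)) i j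
      ≈⟨ +-congˡ (-‿cong (padded-interior (doubleDifference F) row₀ col₀ i j)) ⟩
    F i j - doubleDifference F i j
      ≈⟨ x-[x-y]≈y (F i j) _ ⟩
    F zero j - (F zero zero - F i zero) ∎
    where
    row₀ : ∀ j → doubleDifference F zero j ≈ 0#
    row₀ j = trans (x-[x-y]≈y (F zero j) _) (-‿inverseʳ (F zero zero))
    col₀ : ∀ i → doubleDifference F i zero ≈ 0#
    col₀ i = trans (+-congˡ (-‿cong (x-[x-y]≈y (F zero zero) (F i zero)))) (-‿inverseʳ (F i zero))

  padded-rowColumn⇒0 : ∀ a (u : Fin (suc k′) → Carrier) (v : Fin (suc m′) → Carrier) →
                       (∀ i j → padded a i j ≈ v j - u i) → ∀ t → a t ≈ 0#
  padded-rowColumn⇒0 a u v padded≈v-u t = begin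
    a t                                    ≡⟨ cong a (combine-remQuot {k′} m′ t) ⟨
    uncurry (padded a) (interiorIndex t)   ≈⟨ uncurry padded≈v-u (interiorIndex t) ⟩
    uncurry (λ i j → v j - u i) (interiorIndex t)
                                           ≈⟨ x≈y⇒x∙y⁻¹≈ε (uncurry (λ i j → v≈u j i) (interiorIndex t)) ⟩
    0#                                     ∎
    where
    v≈u₀ : ∀ j → v j ≈ u zero
    v≈u₀ j = x∙y⁻¹≈ε⇒x≈y _ _ (sym (padded≈v-u zero j))
    v₀≈u : ∀ i → v zero ≈ u i
    v₀≈u zero = v≈u₀ zero
    v₀≈u (suc p) = x∙y⁻¹≈ε⇒x≈y _ _ (sym (padded≈v-u (suc p) zero))
    v≈u : ∀ j i → v j ≈ u i
    v≈u j i = trans (v≈u₀ j) (trans (sym (v₀≈u zero)) (v₀≈u i))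

module CochainProperties {c ℓ : Level} (K : Field c ℓ) (G : Digraph) where
  open Field K hiding (zero)
    renaming (refl to ≈-refl; sym to ≈-sym; trans to ≈-trans; reflexive to ≈-reflexive)
  open RingProperties ring using (-0#≈0#)
  open Digraph G
  open MultipathCohomology K G

  sumFin-cong : ∀ {n} {f g : Fin n → Carrier} → (∀ x → f x ≈ g x) → sumFin f ≈ sumFin g
  sumFin-cong {zero} _ = ≈-refl
  sumFin-cong {suc n} f≈g = +-cong (f≈g zero) (sumFin-cong (f≈g ∘ suc))

  sumFin-splitAt : ∀ k {m} (f : Fin (k +ℕ m) → Carrier) →
                   sumFin f ≈ sumFin (f ∘ (_↑ˡ m)) + sumFin (f ∘ (k ↑ʳ_))
  sumFin-splitAt zero f = ≈-sym (+-identityˡ _)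
  sumFin-splitAt (suc k) f = ≈-trans (+-congˡ (sumFin-splitAt k (f ∘ suc))) (≈-sym (+-assoc _ _ _))

  sumFin-zero : ∀ {n} {f : Fin n → Carrier} → (∀ x → f x ≈ 0#) → sumFin f ≈ 0#
  sumFin-zero {zero} _ = ≈-refl
  sumFin-zero {suc n} f≈0 = ≈-trans (+-cong (f≈0 zero) (sumFin-zero (f≈0 ∘ suc))) (+-identityˡ 0#)

  sumFin-single : ∀ {n} {f : Fin n → Carrier} x₀ → (∀ x → x ≢ x₀ → f x ≈ 0#) → sumFin f ≈ f x₀
  sumFin-single zero f≈0 =
    ≈-trans (+-congˡ (sumFin-zero (λ x → f≈0 (suc x) (λ ())))) (+-identityʳ _)
  sumFin-single (suc x₀) f≈0 =
    ≈-trans (+-congʳ (f≈0 zero (λ ()))) (≈-trans (+-identityˡ _)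
      (sumFin-single x₀ (λ x x≢x₀ → f≈0 (suc x) (x≢x₀ ∘ suc-injective))))

  sumOver : ∀ {n} → Subset n → (Fin n → Carrier) → Carrier
  sumOver p w = sumFin (λ x → if does (x ∈? p) then w x else 0#)

  sumOver-++ : ∀ {k m} (A : Subset k) (B : Subset m) w →
               sumOver (A ++ B) w ≈ sumOver A (w ∘ (_↑ˡ m)) + sumOver B (w ∘ (k ↑ʳ_))
  sumOver-++ {k} {m} A B w = ≈-trans (sumFin-splitAt k _) (+-cong
    (sumFin-cong λ i → ≈-reflexive (cong (λ b → if b then w (i ↑ˡ m) else 0#) (∈?-↑ˡ A B i)))
    (sumFin-cong λ j → ≈-reflexive (cong (λ b → if b then w (k ↑ʳ j) else 0#) (∈?-↑ʳ A B j))))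

  sumOver-⟦⟧ : ∀ {n} (a : Maybe (Fin n)) w → sumOver ⟦ a ⟧ w ≈ maybe′ w 0# a
  sumOver-⟦⟧ nothing w =
    sumFin-zero λ x → ≈-reflexive (cong (λ b → if b then w x else 0#) (dec-false (x ∈? ⊥) ∉⊥))
  sumOver-⟦⟧ (just i) w = ≈-trans
    (sumFin-single i λ x x≢i →
      ≈-reflexive (cong (λ b → if b then w x else 0#) (dec-false (x ∈? ⁅ i ⁆) (x≢y⇒x∉⁅y⁆ x≢i))))
    (≈-reflexive (cong (λ b → if b then w i else 0#) (dec-true (i ∈? ⁅ i ⁆) (x∈⁅x⁆ i))))

  isCoboundary-resp : ∀ i {f g} → (∀ H → f H ≈ g H) → IsCoboundary i f → IsCoboundary i g
  isCoboundary-resp zero f≈g (lift f≈0) =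
    lift λ H H-multipath ∣H∣≡ → ≈-trans (≈-sym (f≈g H)) (f≈0 H H-multipath ∣H∣≡)
  isCoboundary-resp (suc i) f≈g (h , f≈dh) =
    h , λ H H-multipath ∣H∣≡ → ≈-trans (≈-sym (f≈g H)) (f≈dh H H-multipath ∣H∣≡)

  exact⇒CohomologyIso-0 : ∀ i → (∀ f → IsCocycle i f → IsCoboundary i f) → CohomologyIso i 0
  exact⇒CohomologyIso-0 i exact =
    (λ ()) , (λ ()) , (λ f cocycle → (λ ()) , isCoboundary-resp i f≈f-0 (exact f cocycle)) , (λ _ _ ())
    where
    f≈f-0 : ∀ {f : Cochain} H → f H ≈ f H - 0#
    f≈f-0 H = ≈-sym (≈-trans (+-congˡ -0#≈0#) (+-identityʳ _))

  module Ranked (rank : Fin V → ℕ) (rank-increasing : ∀ e → rank (src e) < rank (tgt e)) where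

    rank-walk : ∀ {u es w} → Walk u es w → rank u ≤ rank w
    rank-walk {es = []} ≡.refl = ≤-refl
    rank-walk {es = e ∷ es} (≡.refl , walk) = ≤-trans (<⇒≤ (rank-increasing e)) (rank-walk walk)

    ¬hasCycle : ∀ H → ¬ HasCycle H
    ¬hasCycle H (e , es , _ , _ , walk) = <⇒≱ (rank-increasing e) (rank-walk walk)

module DandelionMultipaths {c ℓ : Level} (K : Field c ℓ) (k m : ℕ) where
  open Field K hiding (zero)
    renaming (refl to ≈-refl; sym to ≈-sym; trans to ≈-trans; reflexive to ≈-reflexive; _*_ to _·_)
  open RingProperties ring using (-1*x≈-x)
  open Digraph (Dandelion k m)
  open MultipathCohomology K (Dandelion k m)
  open CochainProperties K (Dandelion k m)

  src-↑ˡ : ∀ i → src (i ↑ˡ m) ≡ suc (i ↑ˡ m)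
  src-↑ˡ i rewrite splitAt-↑ˡ k i m = ≡.refl

  tgt-↑ˡ : ∀ i → tgt (i ↑ˡ m) ≡ zero
  tgt-↑ˡ i rewrite splitAt-↑ˡ k i m = ≡.refl

  src-↑ʳ : ∀ j → src (k ↑ʳ j) ≡ zero
  src-↑ʳ j rewrite splitAt-↑ʳ k m j = ≡.refl

  tgt-↑ʳ : ∀ j → tgt (k ↑ʳ j) ≡ suc (k ↑ʳ j)
  tgt-↑ʳ j rewrite splitAt-↑ʳ k m j = ≡.refl

  rank : Fin V → ℕ
  rank zero = 1
  rank (suc v) = [ const 0 , const 2 ]′ (splitAt k v)

  rank-increasing : ∀ e → rank (src e) < rank (tgt e)
  rank-increasing e with splitAt k e
  ... | inj₁ i rewrite splitAt-↑ˡ k i m = s≤s z≤n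
  ... | inj₂ j rewrite splitAt-↑ʳ k m j = s≤s (s≤s z≤n)

  open Ranked rank rank-increasing using (¬hasCycle)

  indeg-++ : ∀ A B v → indeg (A ++ B) v ≡
             count∈ A (λ _ → does (zero ≟ᶠ v)) +ℕ count∈ B (λ j → does (suc (k ↑ʳ j) ≟ᶠ v))
  indeg-++ A B v = ≡.trans (count∈-++ A B _) (cong₂ _+ℕ_
    (count∈-cong A λ i → cong (λ u → does (u ≟ᶠ v)) (tgt-↑ˡ i))
    (count∈-cong B λ j → cong (λ u → does (u ≟ᶠ v)) (tgt-↑ʳ j)))

  outdeg-++ : ∀ A B v → outdeg (A ++ B) v ≡
              count∈ A (λ i → does (suc (i ↑ˡ m) ≟ᶠ v)) +ℕ count∈ B (λ _ → does (zero ≟ᶠ v))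
  outdeg-++ A B v = ≡.trans (count∈-++ A B _) (cong₂ _+ℕ_
    (count∈-cong A λ i → cong (λ u → does (u ≟ᶠ v)) (src-↑ˡ i))
    (count∈-cong B λ j → cong (λ u → does (u ≟ᶠ v)) (src-↑ʳ j)))

  multipath : Maybe (Fin k) → Maybe (Fin m) → Subset E
  multipath a b = ⟦ a ⟧ ++ ⟦ b ⟧

  multipath-isMultipath : ∀ a b → IsMultipath (multipath a b)
  multipath-isMultipath a b = indeg≤1 , outdeg≤1 , ¬hasCycle (multipath a b)
    where
    indeg≤1 : ∀ v → indeg (multipath a b) v ≤ 1
    indeg≤1 zero = ≤-trans (≤-reflexive (indeg-++ ⟦ a ⟧ ⟦ b ⟧ zero))
      (+-mono-≤ (count∈-⟦⟧≤1 a _) (≤-reflexive (count∈-none ⟦ b ⟧ λ _ _ → ≡.refl)))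
    indeg≤1 (suc v) = ≤-trans (≤-reflexive (indeg-++ ⟦ a ⟧ ⟦ b ⟧ (suc v)))
      (+-mono-≤ (≤-reflexive (count∈-none ⟦ a ⟧ λ _ _ → ≡.refl)) (count∈-⟦⟧≤1 b _))
    outdeg≤1 : ∀ v → outdeg (multipath a b) v ≤ 1
    outdeg≤1 zero = ≤-trans (≤-reflexive (outdeg-++ ⟦ a ⟧ ⟦ b ⟧ zero))
      (+-mono-≤ (≤-reflexive (count∈-none ⟦ a ⟧ λ _ _ → ≡.refl)) (count∈-⟦⟧≤1 b _))
    outdeg≤1 (suc v) = ≤-trans (≤-reflexive (outdeg-++ ⟦ a ⟧ ⟦ b ⟧ (suc v)))
      (+-mono-≤ (count∈-⟦⟧≤1 a _) (≤-reflexive (count∈-none ⟦ b ⟧ λ _ _ → ≡.refl)))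

  isMultipath⇒multipath : ∀ {H} → IsMultipath H → ∃₂ λ a b → H ≡ multipath a b
  isMultipath⇒multipath {H} (indeg≤1 , outdeg≤1 , _) with Vec.splitAt k H
  ... | A , B , ≡.refl with ∣p∣≤1⇒p≡⟦⟧ A (subst (_≤ 1) indeg≡∣A∣ (indeg≤1 zero))
                          | ∣p∣≤1⇒p≡⟦⟧ B (subst (_≤ 1) outdeg≡∣B∣ (outdeg≤1 zero))
    where
    indeg≡∣A∣ : indeg (A ++ B) zero ≡ ∣ A ∣
    indeg≡∣A∣ = ≡.trans (indeg-++ A B zero)
      (≡.trans (cong₂ _+ℕ_ (count∈-all A λ _ → ≡.refl) (count∈-none B λ _ _ → ≡.refl))
               (ℕ.+-identityʳ ∣ A ∣))
    outdeg≡∣B∣ : outdeg (A ++ B) zero ≡ ∣ B ∣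
    outdeg≡∣B∣ = ≡.trans (outdeg-++ A B zero)
      (cong₂ _+ℕ_ (count∈-none A λ _ _ → ≡.refl) (count∈-all B λ _ → ≡.refl))
  ... | a , ≡.refl | b , ≡.refl = a , b , ≡.refl

  ∣multipath∣ : ∀ a b → ∣ multipath a b ∣ ≡ size a +ℕ size b
  ∣multipath∣ a b = ≡.trans (∣++∣ ⟦ a ⟧ ⟦ b ⟧) (cong₂ _+ℕ_ (∣⟦⟧∣ a) (∣⟦⟧∣ b))

  multipath-of-degree : ∀ {H i} → IsMultipath H → ∣ H ∣ ≡ i →
                        ∃₂ λ a b → H ≡ multipath a b × size a +ℕ size b ≡ i
  multipath-of-degree H-multipath ≡.refl with isMultipath⇒multipath H-multipath
  ... | a , b , ≡.refl = a , b , ≡.refl , ≡.sym (∣multipath∣ a b)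

  degree≤2 : ∀ {H} → IsMultipath H → ∣ H ∣ ≤ 2
  degree≤2 H-multipath with isMultipath⇒multipath H-multipath
  ... | a , b , ≡.refl = subst (_≤ 2) (≡.sym (∣multipath∣ a b)) (+-mono-≤ (size≤1 a) (size≤1 b))

  ∅ : Subset E
  ∅ = multipath nothing nothing

  inEdge : Fin k → Subset E
  inEdge i = multipath (just i) nothing

  outEdge : Fin m → Subset E
  outEdge j = multipath nothing (just j)

  path : Fin k → Fin m → Subset E
  path i j = multipath (just i) (just j)

  path-isMultipath : ∀ i j → IsMultipath (path i j)
  path-isMultipath i j = multipath-isMultipath (just i) (just j)

  ∣path∣ : ∀ i j → ∣ path i j ∣ ≡ 2
  ∣path∣ i j = ∣multipath∣ (just i) (just j)

  path-injective : ∀ {i i′ j j′} → path i j ≡ path i′ j′ → i ≡ i′ × j ≡ j′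
  path-injective {i} {i′} eq with ++-injective ⁅ i ⁆ ⁅ i′ ⁆ eq
  ... | ⁅i⁆≡⁅i′⁆ , ⁅j⁆≡⁅j′⁆ = ⁅⁆-injective ⁅i⁆≡⁅i′⁆ , ⁅⁆-injective ⁅j⁆≡⁅j′⁆

  ε-in : ∀ i b → ε (multipath (just i) b) (i ↑ˡ m) ≡ 0
  ε-in i b = ≡.trans (count∈-++ ⁅ i ⁆ ⟦ b ⟧ _) (cong₂ _+ℕ_
    (count∈-⁅⁆ i (dec-false (i ↑ˡ m <ᶠ? i ↑ˡ m) (<-irrefl ≡.refl)))
    (count∈-none ⟦ b ⟧ λ j _ → dec-false (k ↑ʳ j <ᶠ? i ↑ˡ m) (<-asym (↑ˡ<↑ʳ i j))))

  ε-out : ∀ a j → ε (multipath a (just j)) (k ↑ʳ j) ≡ size a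
  ε-out a j = ≡.trans (count∈-++ ⟦ a ⟧ ⁅ j ⁆ _) (≡.trans (cong₂ _+ℕ_
    (≡.trans (count∈-all ⟦ a ⟧ λ i → dec-true (i ↑ˡ m <ᶠ? k ↑ʳ j) (↑ˡ<↑ʳ i j)) (∣⟦⟧∣ a))
    (count∈-⁅⁆ j (dec-false (k ↑ʳ j <ᶠ? k ↑ʳ j) (<-irrefl ≡.refl))))
    (ℕ.+-identityʳ (size a)))

  in-removed : ∀ i b → multipath (just i) b ∖ (i ↑ˡ m) ≡ multipath nothing b
  in-removed i b = ≡.trans (++-∖-↑ˡ ⁅ i ⁆ ⟦ b ⟧ i) (cong (_++ ⟦ b ⟧) (⁅x⁆∖x≡⊥ i))

  out-removed : ∀ a j → multipath a (just j) ∖ (k ↑ʳ j) ≡ multipath a nothing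
  out-removed a j = ≡.trans (++-∖-↑ʳ ⟦ a ⟧ ⁅ j ⁆ j) (cong (⟦ a ⟧ ++_) (⁅x⁆∖x≡⊥ j))

  sumOver-multipath : ∀ a b w →
    sumOver (multipath a b) w ≈ maybe′ (w ∘ (_↑ˡ m)) 0# a + maybe′ (w ∘ (k ↑ʳ_)) 0# b
  sumOver-multipath a b w = ≈-trans (sumOver-++ ⟦ a ⟧ ⟦ b ⟧ w) (+-cong (sumOver-⟦⟧ a _) (sumOver-⟦⟧ b _))

  d-multipath : ∀ f a b → d f (multipath a b) ≈
    maybe′ (const (f (multipath nothing b))) 0# a +
    maybe′ (const (sign (size a) · f (multipath a nothing))) 0# b
  d-multipath f a b = ≈-trans (sumOver-multipath a b _) (+-cong (removing-in a) (removing-out b))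
    where
    term : Subset E → Fin E → Carrier
    term T e = sign (ε T e) · f (T ∖ e)
    removing-in : ∀ a → maybe′ (term (multipath a b) ∘ (_↑ˡ m)) 0# a ≈
                        maybe′ (const (f (multipath nothing b))) 0# a
    removing-in nothing = ≈-refl
    removing-in (just i) =
      ≈-trans (≈-reflexive (cong₂ (λ n H → sign n · f H) (ε-in i b) (in-removed i b))) (*-identityˡ _)
    removing-out : ∀ b → maybe′ (term (multipath a b) ∘ (k ↑ʳ_)) 0# b ≈
                         maybe′ (const (sign (size a) · f (multipath a nothing))) 0# b
    removing-out nothing = ≈-refl
    removing-out (just j) = ≈-reflexive (cong₂ (λ n H → sign n · f H) (ε-out a j) (out-removed a j))

  d-inEdge : ∀ f i → d f (inEdge i) ≈ f ∅
  d-inEdge f i = ≈-trans (d-multipath f (just i) nothing) (+-identityʳ _)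

  d-outEdge : ∀ f j → d f (outEdge j) ≈ f ∅
  d-outEdge f j = ≈-trans (d-multipath f nothing (just j)) (≈-trans (+-identityˡ _) (*-identityˡ _))

  d-path : ∀ f i j → d f (path i j) ≈ f (outEdge j) - f (inEdge i)
  d-path f i j = ≈-trans (d-multipath f (just i) (just j)) (+-congˡ (-1*x≈-x _))

module DandelionCohomology {c ℓ : Level} (K : Field c ℓ) (k′ m′ : ℕ) where
  open Field K hiding (zero)
    renaming (refl to ≈-refl; sym to ≈-sym; trans to ≈-trans; reflexive to ≈-reflexive; _*_ to _·_)
  open import Relation.Binary.Reasoning.Setoid setoid
  open Digraph (Dandelion (suc k′) (suc m′)) using (E)
  open MultipathCohomology K (Dandelion (suc k′) (suc m′))
  open CochainProperties K (Dandelion (suc k′) (suc m′))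
  open DandelionMultipaths K (suc k′) (suc m′)
  open RowColumnMatrices ring k′ m′
  open RingProperties ring using (x∙y⁻¹≈ε⇒x≈y)

  ≈-in-degree≥3 : ∀ x f g → f ≈[ 3 +ℕ x ] g
  ≈-in-degree≥3 x f g H H-multipath ∣H∣≡3+x =
    ⊥-elim (<⇒≱ (s≤s (s≤s (s≤s z≤n))) (subst (_≤ 2) ∣H∣≡3+x (degree≤2 H-multipath)))

  H⁰-exact : ∀ f → IsCocycle 0 f → IsCoboundary 0 f
  H⁰-exact f cocycle = lift vanishes
    where
    vanishes : ∀ H → IsMultipath H → ∣ H ∣ ≡ 0 → f H ≈ 0#
    vanishes H H-multipath ∣H∣≡0 with multipath-of-degree H-multipath ∣H∣≡0
    ... | nothing , nothing , ≡.refl , _ = ≈-trans (≈-sym (d-inEdge f zero))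
      (cocycle (inEdge zero) (multipath-isMultipath (just zero) nothing) (∣multipath∣ (just zero) nothing))
    ... | nothing , just _ , _ , ()
    ... | just _ , _ , _ , ()

  cocycle-constant : ∀ f → IsCocycle 1 f → ∀ i j → f (outEdge j) ≈ f (inEdge i)
  cocycle-constant f cocycle i j = x∙y⁻¹≈ε⇒x≈y _ _
    (≈-trans (≈-sym (d-path f i j)) (cocycle (path i j) (path-isMultipath i j) (∣path∣ i j)))

  H¹-exact : ∀ f → IsCocycle 1 f → IsCoboundary 1 f
  H¹-exact f cocycle = g , agrees
    where
    g : Cochain
    g = const (f (inEdge zero))
    agrees : ∀ H → IsMultipath H → ∣ H ∣ ≡ 1 → f H ≈ d g H
    agrees H H-multipath ∣H∣≡1 with multipath-of-degree H-multipath ∣H∣≡1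
    ... | just i , nothing , ≡.refl , _ = begin
      f (inEdge i)      ≈⟨ cocycle-constant f cocycle i zero ⟨
      f (outEdge zero)  ≈⟨ cocycle-constant f cocycle zero zero ⟩
      f (inEdge zero)   ≈⟨ d-inEdge g i ⟨
      d g (inEdge i)    ∎
    ... | nothing , just j , ≡.refl , _ = ≈-trans (cocycle-constant f cocycle zero j) (≈-sym (d-outEdge g j))
    ... | nothing , nothing , _ , ()
    ... | just _ , just _ , _ , ()

  H³⁺-exact : ∀ x f → IsCocycle (3 +ℕ x) f → IsCoboundary (3 +ℕ x) f
  H³⁺-exact x f _ = const 0# , ≈-in-degree≥3 x f _

  interiorPath : Fin (k′ * m′) → Subset E
  interiorPath = uncurry path ∘ interiorIndex

  basis : Fin (k′ * m′) → Cochain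
  basis t H = if does (H ≟ₛ interiorPath t) then 1# else 0#

  basis-on : ∀ t → basis t (interiorPath t) ≈ 1#
  basis-on t =
    ≈-reflexive (cong (λ b → if b then 1# else 0#) (dec-true (interiorPath t ≟ₛ interiorPath t) ≡.refl))

  basis-off : ∀ t i j → (i , j) ≢ interiorIndex t → basis t (path i j) ≈ 0#
  basis-off t i j ij≢ =
    ≈-reflexive (cong (λ b → if b then 1# else 0#) (dec-false (path i j ≟ₛ interiorPath t) path≢))
    where
    path≢ : path i j ≢ interiorPath t
    path≢ eq = ij≢ (uncurry (cong₂ _,_)
      (path-injective {i} {proj₁ (interiorIndex t)} {j} {proj₂ (interiorIndex t)} eq))

  lincomb-basis : ∀ a i j → lincomb a basis (path i j) ≈ padded a i j
  lincomb-basis a zero j =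
    sumFin-zero λ t → ≈-trans (*-congˡ (basis-off t zero j (0≢1+n ∘ cong proj₁))) (zeroʳ _)
  lincomb-basis a (suc p) zero =
    sumFin-zero λ t → ≈-trans (*-congˡ (basis-off t (suc p) zero (0≢1+n ∘ cong proj₂))) (zeroʳ _)
  lincomb-basis a (suc p) (suc q) = ≈-trans (sumFin-single (combine p q) off) (begin
    a (combine p q) · basis (combine p q) (path (suc p) (suc q))
      ≡⟨ cong (λ ij → a (combine p q) · basis (combine p q) (uncurry path ij)) (interiorIndex-combine p q) ⟨
    a (combine p q) · basis (combine p q) (interiorPath (combine p q))
      ≈⟨ *-congˡ (basis-on (combine p q)) ⟩
    a (combine p q) · 1#
      ≈⟨ *-identityʳ _ ⟩
    a (combine p q) ∎)
    where
    off : ∀ t → t ≢ combine p q → a t · basis t (path (suc p) (suc q)) ≈ 0#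
    off t t≢pq =
      ≈-trans (*-congˡ (basis-off t (suc p) (suc q) (t≢pq ∘ interiorIndex≡⇒≡combine t ∘ ≡.sym))) (zeroʳ _)

  edgeCochain : (Fin (suc k′) → Carrier) → (Fin (suc m′) → Carrier) → Cochain
  edgeCochain u v H = sumOver H ([ u , v ]′ ∘ splitAt (suc k′))

  edgeCochain-inEdge : ∀ u v i → edgeCochain u v (inEdge i) ≈ u i
  edgeCochain-inEdge u v i =
    ≈-trans (sumOver-multipath (just i) nothing ([ u , v ]′ ∘ splitAt (suc k′)))
    (≈-trans (+-identityʳ _) (≈-reflexive (cong [ u , v ]′ (splitAt-↑ˡ (suc k′) i (suc m′)))))

  edgeCochain-outEdge : ∀ u v j → edgeCochain u v (outEdge j) ≈ v j
  edgeCochain-outEdge u v j =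
    ≈-trans (sumOver-multipath nothing (just j) ([ u , v ]′ ∘ splitAt (suc k′)))
    (≈-trans (+-identityˡ _) (≈-reflexive (cong [ u , v ]′ (splitAt-↑ʳ (suc k′) (suc m′) j))))

  d-edgeCochain : ∀ u v i j → d (edgeCochain u v) (path i j) ≈ v j - u i
  d-edgeCochain u v i j = ≈-trans (d-path (edgeCochain u v) i j)
    (+-cong (edgeCochain-outEdge u v j) (-‿cong (edgeCochain-inEdge u v i)))

  H²-surjective : ∀ f → IsCocycle 2 f →
                  Σ (Fin (k′ * m′) → Carrier) λ a → IsCoboundary 2 (f −C lincomb a basis)
  H²-surjective f _ = a , g , agrees
    where
    F : Matrix
    F i j = f (path i j)
    a : Fin (k′ * m′) → Carrier
    a = interior (doubleDifference F)
    g : Cochain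
    g = edgeCochain (λ i → F zero zero - F i zero) (F zero)
    agrees : ∀ H → IsMultipath H → ∣ H ∣ ≡ 2 → f H - lincomb a basis H ≈ d g H
    agrees H H-multipath ∣H∣≡2 with multipath-of-degree H-multipath ∣H∣≡2
    ... | just i , just j , ≡.refl , _ = begin
      F i j - lincomb a basis (path i j)   ≈⟨ +-congˡ (-‿cong (lincomb-basis a i j)) ⟩
      F i j - padded a i j                 ≈⟨ padded-doubleDifference F i j ⟩
      F zero j - (F zero zero - F i zero)  ≈⟨ d-edgeCochain (λ i → F zero zero - F i zero) (F zero) i j ⟨
      d g (path i j)                       ∎
    ... | nothing , nothing , _ , ()
    ... | nothing , just _ , _ , ()
    ... | just _ , nothing , _ , ()

  H²-injective : ∀ a → IsCoboundary 2 (lincomb a basis) → ∀ t → a t ≈ 0#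
  H²-injective a (g , lincomb≈dg) = padded-rowColumn⇒0 a (g ∘ inEdge) (g ∘ outEdge) λ i j → begin
    padded a i j                ≈⟨ lincomb-basis a i j ⟨
    lincomb a basis (path i j)  ≈⟨ lincomb≈dg (path i j) (path-isMultipath i j) (∣path∣ i j) ⟩
    d g (path i j)              ≈⟨ d-path g i j ⟩
    g (outEdge j) - g (inEdge i) ∎

  H²≅K^[k′*m′] : CohomologyIso 2 (k′ * m′)
  H²≅K^[k′*m′] = basis , (λ t → ≈-in-degree≥3 0 (d (basis t)) zeroC) , H²-surjective , H²-injective

  H⁰≅0 : CohomologyIso 0 0
  H⁰≅0 = exact⇒CohomologyIso-0 0 H⁰-exact

  H¹≅0 : CohomologyIso 1 0
  H¹≅0 = exact⇒CohomologyIso-0 1 H¹-exact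

  H³⁺≅0 : ∀ x → CohomologyIso (3 +ℕ x) 0
  H³⁺≅0 x = exact⇒CohomologyIso-0 (3 +ℕ x) (H³⁺-exact x)

proposition4p21 : {c ℓ : Level} (K : Field c ℓ) (n k : ℕ) → 2 < n → 0 < k → k < n →
    (H[ K , Dandelion k (n ∸ k) ]≅K^ ((k ∸ 1) * (n ∸ k ∸ 1))) 2 ×
    (∀ i → ¬ i ≡ 2 → (H[ K , Dandelion k (n ∸ k) ]≅K^ 0) i)
proposition4p21 K n (suc k′) _ _ k<n with n ∸ suc k′ | m<n⇒0<n∸m k<n
... | suc m′ | _ = H²≅K^[k′*m′] , vanishing
  where
  open DandelionCohomology K k′ m′
  vanishing : ∀ i → ¬ i ≡ 2 → (H[ K , Dandelion (suc k′) (suc m′) ]≅K^ 0) i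
  vanishing 0 _ = H⁰≅0
  vanishing 1 _ = H¹≅0
  vanishing 2 i≢2 = ⊥-elim (i≢2 ≡.refl)
  vanishing (suc (suc (suc x))) _ = H³⁺≅0 x
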